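{- If $g$ is a permutation of a finite set $\Omega$ and $C=\langle g \rangle$, then $$\frac{o(g)}{\ell(g)} = \frac{ \min \{ |C_\omega| : \omega \in \Omega\} }{ \gcd \{ |C_\omega| : \omega \in \Omega\} }.$$
   Context: $o(g)$ is the order of $g$, $\ell(g)$ the length of a longest orbit of $\langle g\rangle$, and $C_\omega$ the stabiliser of $\omega$ in $C$. -}

module Defs where

open import Data.Nat using (ℕ; zero; suc; _⊔_; _⊓_; _!)
open import Data.Nat.GCD using (gcd)

open import Data.Fin using (Fin)
open import Data.Fin.Properties using (all?; _≟_)
open import Data.Fin.Permutation using (Permutation′; _⟨$⟩ʳ_)
open import Data.List using (List; []; _∷_; length; filter; upTo; allFin; map; foldr)
open import Data.List.Relation.Unary.Any using (any?)
open import Data.Bool using (Bool; if_then_else_)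
open import Relation.Nullary using (does)

iter : ∀ {n} → Permutation′ n → ℕ → Fin n → Fin n
iter g zero    x = x
iter g (suc k) x = g ⟨$⟩ʳ iter g k x

isIdPow : ∀ {n} → Permutation′ n → ℕ → Bool
isIdPow {n} g k = does (all? (λ x → iter g k x ≟ x))

-- least k in [i, i + fuel) with g^k = id  (0 if none)
searchOrder : ∀ {n} → Permutation′ n → ℕ → ℕ → ℕ
searchOrder g i zero       = 0
searchOrder g i (suc fuel) =
  if isIdPow g i then i else searchOrder g (suc i) fuel

-- o(g): the least positive k with g^k = id.  The search range is
-- [1, n!], which always contains o(g) (Lagrange in Sym(n)).
order : ∀ {n} → Permutation′ n → ℕ
order {n} g = searchOrder g 1 (n !)

-- C = ⟨g⟩ = { g^k : k < o(g) } (these are pairwise distinct).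

orbitSize : ∀ {n} → Permutation′ n → Fin n → ℕ
orbitSize {n} g ω =
  length (filter (λ y → any? (λ k → iter g k ω ≟ y) (upTo (order g))) (allFin n))

stabSize : ∀ {n} → Permutation′ n → Fin n → ℕ
stabSize g ω = length (filter (λ k → iter g k ω ≟ ω) (upTo (order g)))

longestOrbit : ∀ {n} → Permutation′ n → ℕ
longestOrbit {n} g = foldr _⊔_ 0 (map (orbitSize g) (allFin n))

minimum⁺ : ℕ → List ℕ → ℕ
minimum⁺ a xs = foldr _⊓_ a xs

minStab : ∀ {m} → Permutation′ (suc m) → ℕ
minStab {m} g = minimum⁺ (stabSize g Fin.zero) (map (stabSize g) (allFin (suc m)))
  where import Data.Fin as Fin

gcdStab : ∀ {n} → Permutation′ n → ℕ
gcdStab {n} g = foldr gcd 0 (map (stabSize g) (allFin n))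

{-# OPTIONS --safe #-}
module Submission where

open import Defs
open import Data.Nat using (ℕ; suc; _*_)
open import Data.Fin.Permutation using (Permutation′)
open import Relation.Binary.PropositionalEquality using (_≡_)

open import Algebra.Definitions using (Selective)
open import Data.Bool using (true; false)
open import Data.Fin as Fin using (Fin)
open import Data.Fin.Properties using (all?; _≟_)
open import Data.Fin.Permutation using (_⟨$⟩ʳ_; _⟨$⟩ˡ_; inverseˡ)
open import Data.List using (List; []; _∷_; _++_; length; filter; upTo; applyUpTo; allFin; map; foldr)
open import Data.List.Membership.Propositional using (_∈_; lose)
open import Data.List.Membership.Propositional.Properties
  using (∈-allFin; ∈-map⁺; ∈-map⁻; ∈-∃++; ∈-++⁻; ∈-++⁺ˡ; ∈-++⁺ʳ; ∈-filter⁺; ∈-filter⁻; ∈-applyUpTo⁺; ∈-applyUpTo⁻; ∈-upTo⁺; ∈-upTo⁻)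
open import Data.List.Properties using (length-++-sucʳ; length-map; length-upTo; length-applyUpTo; foldr-preservesᵇ; foldr-preservesᵒ)
import Data.List.Relation.Unary.All as All
open import Data.List.Relation.Unary.AllPairs using (_∷_)
open import Data.List.Relation.Unary.Any as Any using (Any; here; there; any?)
open import Data.List.Relation.Unary.Unique.Propositional using (Unique)
open import Data.List.Relation.Unary.Unique.Propositional.Properties using (map⁺; filter⁺; upTo⁺; allFin⁺; applyUpTo⁺₁)
open import Data.Nat using (zero; _+_; _∸_; _≤_; _<_; z≤n; z<s; s≤s; s≤s⁻¹; pred; _!; NonZero; >-nonZero; ≢-nonZero; _⊔_; _⊓_)
open import Data.Nat.DivMod using (_%_; _/_; m≡m%n+[m/n]*n; m%n<n)
open import Data.Nat.Divisibility using (_∣_; divides; ∣-refl; ∣-trans; ∣⇒≤; m%n≡0⇒n∣m)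
open import Data.Nat.GCD using (gcd; gcd[m,n]∣m; gcd[m,n]∣n)
open import Data.Nat.Properties hiding (_≟_)
open import Algebra.Properties.CommutativeSemigroup *-commutativeSemigroup using (xy∙z≈xz∙y)
open import Data.Product using (∃-syntax; _×_; _,_; proj₂)
open import Data.Sum using (_⊎_; inj₁; inj₂; [_,_])
open import Function using (_∘_)
open import Relation.Binary.PropositionalEquality using (refl; sym; trans; cong; cong₂; subst; subst₂; _≢_; module ≡-Reasoning)
open import Relation.Nullary using (¬_; Dec; does; yes; no; contradiction)
open import Relation.Unary using (Decidable)

-- For a point ω let p_ω be the least k > 0 with g^k ω = ω.  Then g^k fixes ω iff
-- p_ω ∣ k, so p_ω ∣ o(g), the orbit of ω is {g^k ω : k < p_ω} and |C_ω| · p_ω = o(g).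
-- Hence a point with smallest stabiliser lies on a longest orbit, and
-- min |C_ω| · ℓ(g) = o(g).  If d divides o(g) and every |C_ω|, then every p_ω divides
-- o(g)/d, so g^(o(g)/d) = 1 and the minimality of o(g) forces d = 1: the gcd is 1.

Unique-⊆⇒length≤ : ∀ {A : Set} {xs ys : List A} → Unique xs → (∀ {z} → z ∈ xs → z ∈ ys) → length xs ≤ length ys
Unique-⊆⇒length≤ {xs = []} _ _ = z≤n
Unique-⊆⇒length≤ {xs = x ∷ xs} (x∉xs ∷ xs!) xs⊆ys
  with ys₁ , ys₂ , refl ← ∈-∃++ (xs⊆ys (here refl))
  rewrite length-++-sucʳ ys₁ x ys₂ = s≤s (Unique-⊆⇒length≤ xs! xs⊆ys₁++ys₂)
  where
  xs⊆ys₁++ys₂ : ∀ {z} → z ∈ xs → z ∈ ys₁ ++ ys₂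
  xs⊆ys₁++ys₂ z∈xs with ∈-++⁻ ys₁ (xs⊆ys (there z∈xs))
  ... | inj₁ z∈ys₁ = ∈-++⁺ˡ z∈ys₁
  ... | inj₂ (here refl) = contradiction refl (All.lookup x∉xs z∈xs)
  ... | inj₂ (there z∈ys₂) = ∈-++⁺ʳ ys₁ z∈ys₂

Unique-same-members⇒length≡ : ∀ {A : Set} {xs ys : List A} → Unique xs → Unique ys →
  (∀ {z} → z ∈ xs → z ∈ ys) → (∀ {z} → z ∈ ys → z ∈ xs) → length xs ≡ length ys
Unique-same-members⇒length≡ xs! ys! xs⊆ys ys⊆xs =
  ≤-antisym (Unique-⊆⇒length≤ xs! xs⊆ys) (Unique-⊆⇒length≤ ys! ys⊆xs)

foldr-selective : ∀ {A : Set} {_∙_ : A → A → A} → Selective _≡_ _∙_ →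
  ∀ e xs → foldr _∙_ e xs ≡ e ⊎ foldr _∙_ e xs ∈ xs
foldr-selective {_∙_ = _∙_} sel e xs =
  foldr-preservesᵇ {P = λ v → v ≡ e ⊎ v ∈ xs} pres (inj₁ refl) (All.tabulate (λ x∈xs → inj₂ x∈xs))
  where
  pres : ∀ {x y} → x ≡ e ⊎ x ∈ xs → y ≡ e ⊎ y ∈ xs → (x ∙ y) ≡ e ⊎ (x ∙ y) ∈ xs
  pres {x} {y} px py with sel x y
  ... | inj₁ x∙y≡x = subst (λ v → v ≡ e ⊎ v ∈ xs) (sym x∙y≡x) px
  ... | inj₂ x∙y≡y = subst (λ v → v ≡ e ⊎ v ∈ xs) (sym x∙y≡y) py

∈⇒≤-foldr-⊔ : ∀ {x} e xs → x ∈ xs → x ≤ foldr _⊔_ e xs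
∈⇒≤-foldr-⊔ e xs x∈xs = foldr-preservesᵒ pres e xs (inj₂ (Any.map ≤-reflexive x∈xs))
  where
  pres : ∀ {x} a b → x ≤ a ⊎ x ≤ b → x ≤ a ⊔ b
  pres a b (inj₁ x≤a) = ≤-trans x≤a (m≤m⊔n a b)
  pres a b (inj₂ x≤b) = ≤-trans x≤b (m≤n⊔m a b)

∈⇒foldr-⊓-≤ : ∀ {x} e xs → x ∈ xs → foldr _⊓_ e xs ≤ x
∈⇒foldr-⊓-≤ e xs x∈xs = foldr-preservesᵒ pres e xs (inj₂ (Any.map (≤-reflexive ∘ sym) x∈xs))
  where
  pres : ∀ {x} a b → a ≤ x ⊎ b ≤ x → a ⊓ b ≤ x
  pres a b (inj₁ a≤x) = ≤-trans (m⊓n≤m a b) a≤x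
  pres a b (inj₂ b≤x) = ≤-trans (m⊓n≤n a b) b≤x

∈⇒foldr-gcd-∣ : ∀ {x} e xs → x ∈ xs → foldr gcd e xs ∣ x
∈⇒foldr-gcd-∣ e xs x∈xs = foldr-preservesᵒ pres e xs (inj₂ (Any.map (λ { refl → ∣-refl }) x∈xs))
  where
  pres : ∀ {x} a b → a ∣ x ⊎ b ∣ x → gcd a b ∣ x
  pres a b (inj₁ a∣x) = ∣-trans (gcd[m,n]∣m a b) a∣x
  pres a b (inj₂ b∣x) = ∣-trans (gcd[m,n]∣n a b) b∣x

*-≡-of-extremes : ∀ {a b c d n} → a * b ≡ n → c * d ≡ n → a ≤ c → b ≤ d → a * d ≡ n
*-≡-of-extremes {a} {b} {c} {d} {n} ab≡n cd≡n a≤c b≤d = ≤-antisym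
  (begin a * d ≤⟨ *-monoˡ-≤ d a≤c ⟩ c * d ≡⟨ cd≡n ⟩ n ∎)
  (begin n ≡⟨ ab≡n ⟨ a * b ≤⟨ *-monoʳ-≤ a b≤d ⟩ a * d ∎)
  where open ≤-Reasoning

record LeastWitness (P : ℕ → Set) : Set where
  field
    least : ℕ
    holds : P least
    below : ∀ {k} → k < least → ¬ P k

module _ {P : ℕ → Set} (P? : Decidable P) where

  leastWitness-or-none : ∀ n → LeastWitness P ⊎ (∀ {k} → k < n → ¬ P k)
  leastWitness-or-none zero = inj₂ λ ()
  leastWitness-or-none (suc n) with leastWitness-or-none n | P? n
  ... | inj₁ w    | _      = inj₁ w
  ... | inj₂ none | yes Pn = inj₁ record { least = n ; holds = Pn ; below = none }
  ... | inj₂ none | no ¬Pn = inj₂ λ k<1+n → [ none , (λ { refl → ¬Pn }) ] (m<1+n⇒m<n∨m≡n k<1+n)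

  leastWitness : ∀ {n} → P n → LeastWitness P
  leastWitness {n} Pn with leastWitness-or-none (suc n)
  ... | inj₁ w    = w
  ... | inj₂ none = contradiction Pn (none (n<1+n n))

IsIdentityPower : ∀ {n} → Permutation′ n → ℕ → Set
IsIdentityPower g k = ∀ x → iter g k x ≡ x

record IsOrder {n} (g : Permutation′ n) (o : ℕ) : Set where
  field
    positive : 0 < o
    identity : IsIdentityPower g o
    minimal  : ∀ {k} → 0 < k → k < o → ¬ IsIdentityPower g k

does≡true⇒ : ∀ {A : Set} (a? : Dec A) → does a? ≡ true → A
does≡true⇒ (yes a) _ = a

does≡false⇒ : ∀ {A : Set} (a? : Dec A) → does a? ≡ false → ¬ A
does≡false⇒ (no ¬a) _ = ¬a

module _ {n} (g : Permutation′ n) (k : ℕ) where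

  isIdPow≡true⇒ : isIdPow g k ≡ true → IsIdentityPower g k
  isIdPow≡true⇒ = does≡true⇒ (all? (λ x → iter g k x ≟ x))

  isIdPow≡false⇒ : isIdPow g k ≡ false → ¬ IsIdentityPower g k
  isIdPow≡false⇒ = does≡false⇒ (all? (λ x → iter g k x ≟ x))

searchOrder-spec : ∀ {n} (g : Permutation′ n) i fuel →
  searchOrder g i fuel ≡ 0 ⊎
  (i ≤ searchOrder g i fuel × IsIdentityPower g (searchOrder g i fuel) ×
   (∀ {k} → i ≤ k → k < searchOrder g i fuel → ¬ IsIdentityPower g k))
searchOrder-spec g i zero = inj₁ refl
searchOrder-spec g i (suc fuel) with isIdPow g i in isIdPow≡
... | true  = inj₂ (≤-refl , isIdPow≡true⇒ g i isIdPow≡ , λ i≤k k<i → contradiction (≤-<-trans i≤k k<i) (<-irrefl refl))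
... | false with searchOrder-spec g (suc i) fuel
...   | inj₁ r≡0 = inj₁ r≡0
...   | inj₂ (i<r , id-r , below) = inj₂ (<⇒≤ i<r , id-r , below′)
  where
  below′ : ∀ {k} → i ≤ k → k < searchOrder g (suc i) fuel → ¬ IsIdentityPower g k
  below′ i≤k k<r with m≤n⇒m<n∨m≡n i≤k
  ... | inj₁ i<k  = below i<k k<r
  ... | inj₂ refl = isIdPow≡false⇒ g i isIdPow≡

order≡0⊎isOrder : ∀ {n} (g : Permutation′ n) → order g ≡ 0 ⊎ IsOrder g (order g)
order≡0⊎isOrder {n} g with searchOrder-spec g 1 (n !)
... | inj₁ o≡0 = inj₁ o≡0
... | inj₂ (0<o , id-o , below) = inj₂ record { positive = 0<o ; identity = id-o ; minimal = below }

module _ {n} (g : Permutation′ n) where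

  iter-+ : ∀ a b x → iter g (a + b) x ≡ iter g a (iter g b x)
  iter-+ zero    b x = refl
  iter-+ (suc a) b x = cong (g ⟨$⟩ʳ_) (iter-+ a b x)

  iter-injective : ∀ a {x y} → iter g a x ≡ iter g a y → x ≡ y
  iter-injective zero    eq = eq
  iter-injective (suc a) {x} {y} eq = iter-injective a (begin
    iter g a x                 ≡⟨ inverseˡ g ⟨
    g ⟨$⟩ˡ (g ⟨$⟩ʳ iter g a x) ≡⟨ cong (g ⟨$⟩ˡ_) eq ⟩
    g ⟨$⟩ˡ (g ⟨$⟩ʳ iter g a y) ≡⟨ inverseˡ g ⟩
    iter g a y                 ∎)
    where open ≡-Reasoning

  module _ {p x} (fix : iter g p x ≡ x) where

    iter-*-fixed : ∀ q → iter g (q * p) x ≡ x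
    iter-*-fixed zero    = refl
    iter-*-fixed (suc q) = begin
      iter g (p + q * p) x       ≡⟨ iter-+ p (q * p) x ⟩
      iter g p (iter g (q * p) x) ≡⟨ cong (iter g p) (iter-*-fixed q) ⟩
      iter g p x                 ≡⟨ fix ⟩
      x                          ∎
      where open ≡-Reasoning

    iter-% : .{{_ : NonZero p}} → ∀ k → iter g k x ≡ iter g (k % p) x
    iter-% k = begin
      iter g k x                             ≡⟨ cong (λ j → iter g j x) (m≡m%n+[m/n]*n k p) ⟩
      iter g (k % p + k / p * p) x           ≡⟨ iter-+ (k % p) (k / p * p) x ⟩
      iter g (k % p) (iter g (k / p * p) x)  ≡⟨ cong (iter g (k % p)) (iter-*-fixed (k / p)) ⟩
      iter g (k % p) x                       ∎
      where open ≡-Reasoning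

module _ {n} {g : Permutation′ n} (ord : IsOrder g (order g)) where
  open IsOrder ord

  order≢0 : order g ≢ 0
  order≢0 = m<n⇒n≢0 positive

  instance
    order-nonZero : NonZero (order g)
    order-nonZero = >-nonZero positive

  firstReturn : (ω : Fin n) → LeastWitness (λ k → iter g (suc k) ω ≡ ω)
  firstReturn ω = leastWitness (λ k → iter g (suc k) ω ≟ ω) {pred (order g)}
    (subst (λ j → iter g j ω ≡ ω) (sym (suc-pred (order g))) (identity ω))

  period : Fin n → ℕ
  period ω = suc (LeastWitness.least (firstReturn ω))

  period-fixes : ∀ ω → iter g (period ω) ω ≡ ω
  period-fixes ω = LeastWitness.holds (firstReturn ω)

  period-minimal : ∀ ω {k} → 0 < k → k < period ω → iter g k ω ≢ ω
  period-minimal ω {suc k} _ k<p = LeastWitness.below (firstReturn ω) (s≤s⁻¹ k<p)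

  period∣⇒fixes : ∀ ω {k} → period ω ∣ k → iter g k ω ≡ ω
  period∣⇒fixes ω (divides q refl) = iter-*-fixed g (period-fixes ω) q

  fixes⇒period∣ : ∀ ω {k} → iter g k ω ≡ ω → period ω ∣ k
  fixes⇒period∣ ω {k} fix = m%n≡0⇒n∣m k (period ω) k%p≡0
    where
    k%p≡0 : k % period ω ≡ 0
    k%p≡0 with k % period ω in k%p≡
    ... | zero  = refl
    ... | suc r = contradiction
      (trans (cong (λ j → iter g j ω) (sym k%p≡)) (trans (sym (iter-% g (period-fixes ω) k)) fix))
      (period-minimal ω z<s (subst (_< period ω) k%p≡ (m%n<n k (period ω))))

  period∣order : ∀ ω → period ω ∣ order g
  period∣order ω = fixes⇒period∣ ω (identity ω)

  period-injective : ∀ ω {i j} → i < j → j < period ω → iter g i ω ≢ iter g j ω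
  period-injective ω {i} {j} i<j j<p gⁱω≡gʲω =
    period-minimal ω (m<n⇒0<n∸m i<j) (≤-<-trans (m∸n≤m j i) j<p)
      (iter-injective g i (sym (begin
        iter g i ω                  ≡⟨ gⁱω≡gʲω ⟩
        iter g j ω                  ≡⟨ cong (λ t → iter g t ω) (sym (m+[n∸m]≡n (<⇒≤ i<j))) ⟩
        iter g (i + (j ∸ i)) ω      ≡⟨ iter-+ g i (j ∸ i) ω ⟩
        iter g i (iter g (j ∸ i) ω) ∎)))
    where open ≡-Reasoning

  orbitSize≡period : ∀ ω → orbitSize g ω ≡ period ω
  orbitSize≡period ω = begin
    orbitSize g ω                   ≡⟨ Unique-same-members⇒length≡ (filter⁺ reached? (allFin⁺ n)) cycle! orbit⊆cycle cycle⊆orbit ⟩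
    length cycle                    ≡⟨ length-applyUpTo (λ k → iter g k ω) (period ω) ⟩
    period ω                        ∎
    where
    open ≡-Reasoning
    reached? : Decidable (λ y → Any (λ k → iter g k ω ≡ y) (upTo (order g)))
    reached? y = any? (λ k → iter g k ω ≟ y) (upTo (order g))

    cycle : List (Fin n)
    cycle = applyUpTo (λ k → iter g k ω) (period ω)

    cycle! : Unique cycle
    cycle! = applyUpTo⁺₁ (λ k → iter g k ω) (period ω) (period-injective ω)

    orbit⊆cycle : ∀ {y} → y ∈ filter reached? (allFin n) → y ∈ cycle
    orbit⊆cycle y∈orbit with k , gᵏω≡y ← Any.satisfied (proj₂ (∈-filter⁻ reached? {xs = allFin n} y∈orbit)) =
      subst (_∈ cycle) (trans (sym (iter-% g (period-fixes ω) k)) gᵏω≡y)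
        (∈-applyUpTo⁺ (λ k → iter g k ω) (m%n<n k (period ω)))

    cycle⊆orbit : ∀ {y} → y ∈ cycle → y ∈ filter reached? (allFin n)
    cycle⊆orbit y∈cycle with i , i<p , refl ← ∈-applyUpTo⁻ (λ k → iter g k ω) y∈cycle =
      ∈-filter⁺ reached? (∈-allFin _) (lose (∈-upTo⁺ (<-≤-trans i<p (∣⇒≤ (period∣order ω)))) refl)

  stabSize*period≡order : ∀ ω → stabSize g ω * period ω ≡ order g
  stabSize*period≡order ω with divides q o≡q*p ← period∣order ω = begin
    stabSize g ω * p              ≡⟨ cong (_* p) stabSize≡q ⟩
    q * p                         ≡⟨ o≡q*p ⟨
    order g                       ∎
    where
    open ≡-Reasoning
    p : ℕ
    p = period ω

    fixes? : Decidable (λ k → iter g k ω ≡ ω)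
    fixes? k = iter g k ω ≟ ω

    multiples : List ℕ
    multiples = map (_* p) (upTo q)

    stabiliser⊆multiples : ∀ {k} → k ∈ filter fixes? (upTo (order g)) → k ∈ multiples
    stabiliser⊆multiples {k} k∈stab with ∈-filter⁻ fixes? {xs = upTo (order g)} k∈stab
    ... | k∈upTo , fix with fixes⇒period∣ ω {k} fix
    ...   | divides j refl =
      ∈-map⁺ (_* p) (∈-upTo⁺ (*-cancelʳ-< p j q (subst (j * p <_) o≡q*p (∈-upTo⁻ k∈upTo))))

    multiples⊆stabiliser : ∀ {k} → k ∈ multiples → k ∈ filter fixes? (upTo (order g))
    multiples⊆stabiliser {k} k∈multiples with j , j∈upTo , refl ← ∈-map⁻ (_* p) k∈multiples =
      ∈-filter⁺ fixes? (∈-upTo⁺ (subst (j * p <_) (sym o≡q*p) (*-monoˡ-< p (∈-upTo⁻ j∈upTo))))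
        (period∣⇒fixes ω (divides j refl))

    stabSize≡q : stabSize g ω ≡ q
    stabSize≡q = begin
      stabSize g ω      ≡⟨ Unique-same-members⇒length≡ (filter⁺ fixes? (upTo⁺ (order g)))
                             (map⁺ (λ {i} {j} → *-cancelʳ-≡ i j p) (upTo⁺ q))
                             stabiliser⊆multiples multiples⊆stabiliser ⟩
      length multiples  ≡⟨ length-map (_* p) (upTo q) ⟩
      length (upTo q)   ≡⟨ length-upTo q ⟩
      q                 ∎

  stabSize∣order : ∀ ω → stabSize g ω ∣ order g
  stabSize∣order ω = divides (period ω) (trans (sym (stabSize*period≡order ω)) (*-comm (stabSize g ω) (period ω)))

  stabSizes-coprime : ∀ {d} → d ∣ order g → (∀ ω → d ∣ stabSize g ω) → d ≡ 1
  stabSizes-coprime {d} (divides K o≡K*d) d∣stabSize = ≤-antisym d≤1 (n≢0⇒n>0 d≢0)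
    where
    d≢0 : d ≢ 0
    d≢0 refl = order≢0 (trans o≡K*d (*-zeroʳ K))
    K≢0 : K ≢ 0
    K≢0 refl = order≢0 o≡K*d
    instance
      d-nonZero : NonZero d
      d-nonZero = ≢-nonZero d≢0
      K-nonZero : NonZero K
      K-nonZero = ≢-nonZero K≢0

    -- K = o(g)/d is a multiple of every period, since K · d = o(g) = |C_ω| · p_ω.
    K-identity : IsIdentityPower g K
    K-identity ω with divides t s≡t*d ← d∣stabSize ω = period∣⇒fixes ω (divides t K≡t*p)
      where
      open ≡-Reasoning
      K≡t*p : K ≡ t * period ω
      K≡t*p = *-cancelʳ-≡ K (t * period ω) d (begin
        K * d                 ≡⟨ o≡K*d ⟨
        order g               ≡⟨ stabSize*period≡order ω ⟨
        stabSize g ω * period ω ≡⟨ cong (_* period ω) s≡t*d ⟩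
        t * d * period ω      ≡⟨ xy∙z≈xz∙y t d (period ω) ⟩
        t * period ω * d      ∎)

    d≤1 : d ≤ 1
    d≤1 = *-cancelˡ-≤ K (begin
      K * d   ≡⟨ o≡K*d ⟨
      order g ≤⟨ ≮⇒≥ (λ K<o → minimal (n≢0⇒n>0 K≢0) K<o K-identity) ⟩
      K       ≡⟨ *-identityʳ K ⟨
      K * 1   ∎)
      where open ≤-Reasoning

module _ {m} (g : Permutation′ (suc m)) where

  stabSize∈ : ∀ ω → stabSize g ω ∈ map (stabSize g) (allFin (suc m))
  stabSize∈ ω = ∈-map⁺ (stabSize g) (∈-allFin ω)

  minStab≤stabSize : ∀ ω → minStab g ≤ stabSize g ω
  minStab≤stabSize ω = ∈⇒foldr-⊓-≤ (stabSize g Fin.zero) _ (stabSize∈ ω)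

  minStab-attained : ∃[ ω ] minStab g ≡ stabSize g ω
  minStab-attained with foldr-selective ⊓-sel (stabSize g Fin.zero) (map (stabSize g) (allFin (suc m)))
  ... | inj₁ min≡s₀  = Fin.zero , min≡s₀
  ... | inj₂ min∈map with ω , _ , min≡sω ← ∈-map⁻ (stabSize g) min∈map = ω , min≡sω

  orbitSize≤longestOrbit : ∀ ω → orbitSize g ω ≤ longestOrbit g
  orbitSize≤longestOrbit ω = ∈⇒≤-foldr-⊔ 0 _ (∈-map⁺ (orbitSize g) (∈-allFin ω))

  longestOrbit-attained : longestOrbit g ≡ 0 ⊎ ∃[ ω ] longestOrbit g ≡ orbitSize g ω
  longestOrbit-attained with foldr-selective ⊔-sel 0 (map (orbitSize g) (allFin (suc m)))
  ... | inj₁ ℓ≡0     = inj₁ ℓ≡0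
  ... | inj₂ ℓ∈map with ω , _ , ℓ≡orbω ← ∈-map⁻ (orbitSize g) ℓ∈map = inj₂ (ω , ℓ≡orbω)

  minStab≡0 : order g ≡ 0 → minStab g ≡ 0
  minStab≡0 o≡0 = n≤0⇒n≡0 (subst (minStab g ≤_) stabSize₀≡0 (minStab≤stabSize Fin.zero))
    where
    stabSize₀≡0 : stabSize g Fin.zero ≡ 0
    stabSize₀≡0 = cong (λ o → length (filter (λ k → iter g k Fin.zero ≟ Fin.zero) (upTo o))) o≡0

  module _ (ord : IsOrder g (order g)) where

    gcdStab≡1 : gcdStab g ≡ 1
    gcdStab≡1 = stabSizes-coprime ord (∣-trans (gcdStab∣ Fin.zero) (stabSize∣order ord Fin.zero)) gcdStab∣
      where
      gcdStab∣ : ∀ ω → gcdStab g ∣ stabSize g ω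
      gcdStab∣ ω = ∈⇒foldr-gcd-∣ 0 _ (stabSize∈ ω)

    minStab*longestOrbit≡order : minStab g * longestOrbit g ≡ order g
    minStab*longestOrbit≡order with minStab-attained | longestOrbit-attained
    ... | _ | inj₁ ℓ≡0 = contradiction
      (subst₂ _≤_ (orbitSize≡period ord Fin.zero) ℓ≡0 (orbitSize≤longestOrbit Fin.zero)) λ ()
    ... | a , min≡sa | inj₂ (b , ℓ≡orbb) = begin
      minStab g * longestOrbit g     ≡⟨ cong₂ _*_ min≡sa (trans ℓ≡orbb (orbitSize≡period ord b)) ⟩
      stabSize g a * period ord b    ≡⟨ *-≡-of-extremes (stabSize*period≡order ord a) (stabSize*period≡order ord b) sa≤sb pa≤pb ⟩
      order g                        ∎
      where
      open ≡-Reasoning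
      sa≤sb : stabSize g a ≤ stabSize g b
      sa≤sb = subst (_≤ stabSize g b) min≡sa (minStab≤stabSize b)
      pa≤pb : period ord a ≤ period ord b
      pa≤pb = subst₂ _≤_ (orbitSize≡period ord a) (trans ℓ≡orbb (orbitSize≡period ord b)) (orbitSize≤longestOrbit a)

lemma2p2 : ∀ (m : ℕ) (g : Permutation′ (suc m)) →
    order g * gcdStab g ≡ minStab g * longestOrbit g
lemma2p2 m g with order≡0⊎isOrder g
-- order g = 0 means the search over [1, n!] failed; then every stabiliser is counted
-- over an empty range and both sides vanish.
... | inj₁ o≡0 = begin
  order g * gcdStab g         ≡⟨ cong (_* gcdStab g) o≡0 ⟩
  0                           ≡⟨ cong (_* longestOrbit g) (minStab≡0 g o≡0) ⟨
  minStab g * longestOrbit g  ∎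
  where open ≡-Reasoning
... | inj₂ ord = begin
  order g * gcdStab g         ≡⟨ cong (order g *_) (gcdStab≡1 g ord) ⟩
  order g * 1                 ≡⟨ *-identityʳ (order g) ⟩
  order g                     ≡⟨ minStab*longestOrbit≡order g ord ⟨
  minStab g * longestOrbit g  ∎
  where open ≡-Reasoning
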